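{- Let $\mathcal S=\{s_1,\dots,s_7\}$ and consider the two oriented Steiner triple systems $$\mathcal O(T)=\{[s_1,s_2,s_3],[s_1,s_4,s_5],[s_1,s_7,s_6],[s_2,s_4,s_6],[s_2,s_5,s_7],[s_3,s_4,s_7],[s_3,s_6,s_5]\},$$ $$\mathcal O'(T)=\{[s_1,s_2,s_3],[s_1,s_4,s_5],[s_1,s_7,s_6],[s_2,s_4,s_6],[s_2,s_5,s_7],[s_3,s_4,s_7],[s_3,s_5,s_6]\},$$ with their respective Steiner products on $\mathbb R^{\mathcal S}$. For general (generic) $\mathbf v,\mathbf w\in\mathbb R^{\mathcal S}$, the $7\times7$ real matrix with columns $[\mathbf v],[L^1_{\mathbf w}(\mathbf v)],\dots,[L^6_{\mathbf w}(\mathbf v)]$ has rank $3$ for the Steiner product of $(\mathcal S,\mathcal O(T))$, and has rank $7$ for the Steiner product of $(\mathcal S,\mathcal O'(T))$.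
   Context: $[a,b,c]$ denotes the cyclic ordering $a\to b\to c\to a$ of the triple $\{a,b,c\}$; the underlying triples form the Fano plane on $\mathcal S$ (each pair of distinct points lies in exactly one triple). For an oriented system, the orientation function $f$ has $f(s,s)=0$ and, for distinct $s,s'$ with third point $s''$ of their triple, $f(s,s')=1$ if $[s,s',s'']$ is an oriented triple and $-1$ otherwise. $\mathbb R^{\mathcal S}$ is the real vector space with basis $\mathcal S$; $[\mathbf u]\in\mathbb R^7$ denotes the coordinate column vector of $\mathbf u$ in the basis $s_1,\dots,s_7$. The Steiner product is the bilinear map with $s\times s=0$ and $s\times s'=f(s,s')s''$. $L_{\mathbf w}(\mathbf v)=\mathbf w\times\mathbf v$, $L^0_{\mathbf w}=\mathrm{id}$, $L^{k+1}_{\mathbf w}=L_{\mathbf w}\circ L^k_{\mathbf w}$. "Generic" means for all pairs $(\mathbf v,\mathbf w)$ in a nonempty Zariski-open subset of $\mathbb R^{\mathcal S}\times\mathbb R^{\mathcal S}$.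
   Formalization: Stated over ℚ rather than ℝ: the vectors $\mathbf v,\mathbf w$ have rational coordinates, the Zariski-open set is cut out by a polynomial with rational coefficients, and the rank is taken over ℚ. -}

module Defs where

open import Data.Nat using (ℕ; zero; suc)
open import Data.Bool using (Bool; true; false; _∧_; if_then_else_)
open import Data.Fin using (Fin; zero; suc; _≟_)
open import Data.Product using (_×_; _,_; ∃; ∃-syntax; Σ-syntax)
open import Data.Sum using (_⊎_; inj₁; inj₂; [_,_])
open import Data.Maybe using (Maybe; just; nothing)
open import Data.List using (List; []; _∷_)
open import Data.Rational using (ℚ; 0ℚ; 1ℚ; _+_; _*_; -_)
open import Relation.Nullary using (¬_; does)
open import Relation.Binary.PropositionalEquality using (_≡_; _≢_)
open import Function.Definitions using (Injective)

Pt : Set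
Pt = Fin 7

s₁ s₂ s₃ s₄ s₅ s₆ s₇ : Pt
s₁ = zero
s₂ = suc zero
s₃ = suc (suc zero)
s₄ = suc (suc (suc zero))
s₅ = suc (suc (suc (suc zero)))
s₆ = suc (suc (suc (suc (suc zero))))
s₇ = suc (suc (suc (suc (suc (suc zero)))))

-- Oriented triples [a,b,c] = ⟨ a ⇒ b ⇒ c ⟩ (cyclic order a → b → c → a) and systems.

record OTriple : Set where
  constructor ⟨_⇒_⇒_⟩
  field a b c : Pt

OSystem : Set
OSystem = List OTriple

O-T : OSystem
O-T = ⟨ s₁ ⇒ s₂ ⇒ s₃ ⟩ ∷ ⟨ s₁ ⇒ s₄ ⇒ s₅ ⟩ ∷ ⟨ s₁ ⇒ s₇ ⇒ s₆ ⟩ ∷ ⟨ s₂ ⇒ s₄ ⇒ s₆ ⟩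
    ∷ ⟨ s₂ ⇒ s₅ ⇒ s₇ ⟩ ∷ ⟨ s₃ ⇒ s₄ ⇒ s₇ ⟩ ∷ ⟨ s₃ ⇒ s₆ ⇒ s₅ ⟩ ∷ []

O'-T : OSystem
O'-T = ⟨ s₁ ⇒ s₂ ⇒ s₃ ⟩ ∷ ⟨ s₁ ⇒ s₄ ⇒ s₅ ⟩ ∷ ⟨ s₁ ⇒ s₇ ⇒ s₆ ⟩ ∷ ⟨ s₂ ⇒ s₄ ⇒ s₆ ⟩
     ∷ ⟨ s₂ ⇒ s₅ ⇒ s₇ ⟩ ∷ ⟨ s₃ ⇒ s₄ ⇒ s₇ ⟩ ∷ ⟨ s₃ ⇒ s₅ ⇒ s₆ ⟩ ∷ []

_=ᵇ_ : Pt → Pt → Bool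
x =ᵇ y = does (x ≟ y)

-- For a pair (s,s') of points and an oriented triple [a,b,c]:
-- if {s,s'} ⊆ {a,b,c}, s ≠ s', return (f(s,s'), s'') where s'' is the
-- third point and f(s,s') = 1 iff [s,s',s''] is the given cyclic order.
inTriple : OTriple → Pt → Pt → Maybe (ℚ × Pt)
inTriple ⟨ a ⇒ b ⇒ c ⟩ s s' =
  if (s =ᵇ a) ∧ (s' =ᵇ b) then just (1ℚ , c) else
  if (s =ᵇ b) ∧ (s' =ᵇ c) then just (1ℚ , a) else
  if (s =ᵇ c) ∧ (s' =ᵇ a) then just (1ℚ , b) else
  if (s =ᵇ b) ∧ (s' =ᵇ a) then just (- 1ℚ , c) else
  if (s =ᵇ c) ∧ (s' =ᵇ b) then just (- 1ℚ , a) else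
  if (s =ᵇ a) ∧ (s' =ᵇ c) then just (- 1ℚ , b) else
  nothing

-- (f(s,s'), s'') looked up in the system; nothing when s = s'.
orient : OSystem → Pt → Pt → Maybe (ℚ × Pt)
orient []       s s' = nothing
orient (t ∷ ts) s s' with inTriple t s s'
... | just r  = just r
... | nothing = orient ts s s'

-- Vectors in (the rational version of) ℝ^S, coordinates in basis s₁…s₇.

Vec7 : Set
Vec7 = Pt → ℚ

sumFin : ∀ {n} → (Fin n → ℚ) → ℚ
sumFin {zero}  f = 0ℚ
sumFin {suc n} f = f zero + sumFin (λ i → f (suc i))

-- coefficient of basis vector k in s × s'  (s × s = 0, s × s' = f(s,s') s'')
basisProd : OSystem → Pt → Pt → Pt → ℚ
basisProd O s s' k with orient O s s'
... | nothing       = 0ℚ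
... | just (σ , s'') = if s'' =ᵇ k then σ else 0ℚ

steiner : OSystem → Vec7 → Vec7 → Vec7
steiner O v w k = sumFin (λ i → sumFin (λ j → v i * w j * basisProd O i j k))

L : OSystem → Vec7 → Vec7 → Vec7
L O w v = steiner O w v

Lpow : OSystem → ℕ → Vec7 → Vec7 → Vec7
Lpow O zero    w v = v
Lpow O (suc k) w v = L O w (Lpow O k w v)

Matrix : ℕ → ℕ → Set
Matrix m n = Fin m → Fin n → ℚ

LinIndep : ∀ {m r} → (Fin r → Fin m → ℚ) → Set
LinIndep {m} {r} u =
  (c : Fin r → ℚ) → (∀ i → sumFin {r} (λ j → c j * u j i) ≡ 0ℚ) → ∀ j → c j ≡ 0ℚ

column : ∀ {m n} → Matrix m n → Fin n → Fin m → ℚ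
column M j i = M i j

HasRank : ∀ {m n} → Matrix m n → ℕ → Set
HasRank {m} {n} M r =
  (Σ[ σ ∈ (Fin r → Fin n) ] (Injective _≡_ _≡_ σ × LinIndep (λ j → column M (σ j))))
  × ((σ : Fin (suc r) → Fin n) → Injective _≡_ _≡_ σ
       → ¬ LinIndep (λ j → column M (σ j)))

krylov : OSystem → Vec7 → Vec7 → Matrix 7 7
krylov O v w i j = Lpow O (Data.Fin.toℕ j) w v i

data Poly (V : Set) : Set where
  var  : V → Poly V
  con  : ℚ → Poly V
  _⊕_  : Poly V → Poly V → Poly V
  _⊗_  : Poly V → Poly V → Poly V

eval : ∀ {V} → (V → ℚ) → Poly V → ℚ
eval ρ (var x) = ρ x
eval ρ (con q) = q
eval ρ (p ⊕ q) = eval ρ p + eval ρ q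
eval ρ (p ⊗ q) = eval ρ p * eval ρ q

pairPt : Vec7 → Vec7 → (Pt ⊎ Pt → ℚ)
pairPt v w = [ v , w ]

-- P holds generically: there is a polynomial p whose non-vanishing set
-- D(p) = {(v,w) | p(v,w) ≠ 0} is nonempty, and P holds on all of D(p).
-- (Every nonempty Zariski-open set contains such a basic open D(p).)
Generic : (Vec7 → Vec7 → Set) → Set
Generic P =
  ∃[ p ] ((∃[ v ] ∃[ w ] (eval (pairPt v w) p ≢ 0ℚ))
          × (∀ v w → eval (pairPt v w) p ≢ 0ℚ → P v w))

-- On 𝒪(T) the Steiner product behaves like the seven-dimensional cross product:
-- w × (w × x) = -|w|² x + (w·x) w and w · (w × x) = 0, so L_w³ = -|w|² L_w. Hence every
-- Krylov column is a multiple of one of the columns 0, 1, 2, and by pigeonhole any four columns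
-- contain two multiples of the same vector, so they are dependent.
-- The lower bounds come from fraction-free Gaussian elimination: if the product of its pivots is
-- nonzero, the columns are independent. This product is a polynomial in (v, w). It is nonzero
-- at v = s₁, w = s₁ + s₃ + s₇, where we compute both Krylov matrices explicitly, so the lower
-- bound holds on the whole set where the polynomial is nonzero. For 𝒪'(T), rank ≤ 7 is trivial.
module Submission where

open import Defs

open import Level using (0ℓ)
open import Algebra.Bundles.Raw using (RawRing)
open import Data.Bool using (if_then_else_)
open import Data.Empty using (⊥-elim)
open import Data.Fin using (Fin; zero; suc; toℕ; inject₁; _↑ˡ_; _↑ʳ_)
open import Data.Fin.Induction using (<-weakInduction)
open import Data.Fin.Patterns using (0F; 1F; 2F; 3F; 4F; 5F; 6F)
open import Data.Fin.Properties using (pigeonhole; <⇒≢; injective⇒≤; ↑ˡ-injective; toℕ-inject₁; all?)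
open import Data.List using (foldr)
open import Data.Nat using (ℕ; zero; suc)
open import Data.Nat.Properties using (n<1+n; <-irrefl)
open import Data.Product using (_×_; _,_; ∃-syntax)
open import Data.Rational using (ℚ; 0ℚ; 1ℚ)
open import Data.Rational.Base using (+-*-rawRing; ≢-nonZero)
open import Data.Rational.Properties
  using (*-zeroˡ; *-zeroʳ; *-identityˡ; *-identityʳ; *-assoc; *-inverseʳ; +-identityˡ; +-identityʳ;
         *-distribʳ-+; neg-distribˡ-*; neg-injective)
open import Data.Rational.Solver using (module +-*-Solver)
open import Data.Sum using (_⊎_; inj₁; inj₂)
open import Data.Vec using (Vec; lookup; tabulate; _++_; _∷_; [])
open import Function using (_∘_; id)
open import Function.Definitions using (Injective)
open import Relation.Binary.PropositionalEquality
open import Relation.Nullary using (¬_)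
open import Relation.Nullary.Decidable using (from-yes)

module Sol = +-*-Solver
open Sol using (Polynomial; ⟦_⟧; ⟦_⟧↓; solve; _:=_; _:+_; _:-_; _:*_; :-_; con)

-- Written over a raw ring so that each construction can be read over ℚ, over the polynomials
-- Poly of the genericity statement, and over the ring solver's syntax.
module Over (R : RawRing 0ℓ 0ℓ) where
  open RawRing R
  open import Algebra.Definitions.RawMonoid +-rawMonoid using (sum)

  dot : (Pt → Carrier) → (Pt → Carrier) → Carrier
  dot x y = sum (λ i → x i * y i)

  steinerOver : (ℚ → Carrier) → OSystem → (Pt → Carrier) → (Pt → Carrier) → Pt → Carrier
  steinerOver ι O x y k = sum (λ i → sum (λ j → x i * y j * ι (basisProd O i j k)))

  tripleCross : OTriple → (Pt → Carrier) → (Pt → Carrier) → Pt → Carrier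
  tripleCross ⟨ a ⇒ b ⇒ c ⟩ x y k =
    if k =ᵇ a then x b * y c + - (x c * y b) else
    if k =ᵇ b then x c * y a + - (x a * y c) else
    if k =ᵇ c then x a * y b + - (x b * y a) else 0#

  steinerByTriples : OSystem → (Pt → Carrier) → (Pt → Carrier) → Pt → Carrier
  steinerByTriples O x y k = foldr (λ t s → tripleCross t x y k + s) 0# O

  eliminate : ∀ {m n} → (Fin (suc m) → Fin (suc n) → Carrier) → Fin m → Fin n → Carrier
  eliminate M i j = M zero zero * M (suc i) (suc j) + - (M (suc i) zero * M zero (suc j))

  -- The product of the pivots of fraction-free Gaussian elimination without row exchanges.
  pivotProduct : ∀ {m n} → (Fin m → Fin n → Carrier) → Carrier
  pivotProduct {n = zero}      M = 1#
  pivotProduct {zero} {suc n}  M = 0#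
  pivotProduct {suc m} {suc n} M = M zero zero * pivotProduct (eliminate M)

open import Data.Rational using (_+_; _*_; _-_; -_; 1/_; _≟_)
open Over +-*-rawRing using (dot; steinerByTriples; eliminate; pivotProduct)

q*p≡0⇒q≡0 : ∀ {p q} → p ≢ 0ℚ → q * p ≡ 0ℚ → q ≡ 0ℚ
q*p≡0⇒q≡0 {p} {q} p≢0 qp≡0 = begin
  q                ≡⟨ sym (*-identityʳ q) ⟩
  q * 1ℚ           ≡⟨ cong (q *_) (sym (*-inverseʳ p)) ⟩
  q * (p * 1/ p)   ≡⟨ sym (*-assoc q p (1/ p)) ⟩
  (q * p) * 1/ p   ≡⟨ cong (_* 1/ p) qp≡0 ⟩
  0ℚ * 1/ p        ≡⟨ *-zeroˡ (1/ p) ⟩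
  0ℚ               ∎
  where
    open ≡-Reasoning
    instance _ = ≢-nonZero p≢0

-1*p≡-p : ∀ p → - 1ℚ * p ≡ - p
-1*p≡-p p = trans (sym (neg-distribˡ-* 1ℚ p)) (cong -_ (*-identityˡ p))

sumFin-cong : ∀ {n} {f g : Fin n → ℚ} → f ≗ g → sumFin f ≡ sumFin g
sumFin-cong {zero}  f≗g = refl
sumFin-cong {suc n} f≗g = cong₂ _+_ (f≗g zero) (sumFin-cong (f≗g ∘ suc))

sumFin-≡0 : ∀ {n} {f : Fin n → ℚ} → (∀ i → f i ≡ 0ℚ) → sumFin f ≡ 0ℚ
sumFin-≡0 {zero}  f≡0 = refl
sumFin-≡0 {suc n} f≡0 = cong₂ _+_ (f≡0 zero) (sumFin-≡0 (f≡0 ∘ suc))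

sumFin-distrib-+ : ∀ {n} (f g : Fin n → ℚ) → sumFin (λ i → f i + g i) ≡ sumFin f + sumFin g
sumFin-distrib-+ {zero}  f g = refl
sumFin-distrib-+ {suc n} f g = begin
  f zero + g zero + sumFin (λ i → f (suc i) + g (suc i))
    ≡⟨ cong (f zero + g zero +_) (sumFin-distrib-+ (f ∘ suc) (g ∘ suc)) ⟩
  f zero + g zero + (sumFin (f ∘ suc) + sumFin (g ∘ suc))
    ≡⟨ solve 4 (λ a b c d → a :+ b :+ (c :+ d) := a :+ c :+ (b :+ d)) refl
               (f zero) (g zero) (sumFin (f ∘ suc)) (sumFin (g ∘ suc)) ⟩
  f zero + sumFin (f ∘ suc) + (g zero + sumFin (g ∘ suc))
    ∎
  where open ≡-Reasoning

sumFin-combination : ∀ {n} (c x y : Fin n → ℚ) a b →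
                     sumFin (λ j → c j * (a * x j - b * y j))
                       ≡ a * sumFin (λ j → c j * x j) - b * sumFin (λ j → c j * y j)
sumFin-combination {zero}  c x y a b = solve 2 (λ a b → con 0ℚ := a :* con 0ℚ :- b :* con 0ℚ) refl a b
sumFin-combination {suc n} c x y a b = begin
  c₀ * (a * x₀ - b * y₀) + sumFin (λ j → c′ j * (a * x′ j - b * y′ j))
    ≡⟨ cong (c₀ * (a * x₀ - b * y₀) +_) (sumFin-combination c′ x′ y′ a b) ⟩
  c₀ * (a * x₀ - b * y₀) + (a * Σc′x′ - b * Σc′y′)
    ≡⟨ solve 7 (λ c₀ x₀ y₀ a b X Y → c₀ :* (a :* x₀ :- b :* y₀) :+ (a :* X :- b :* Y)
                                   := a :* (c₀ :* x₀ :+ X) :- b :* (c₀ :* y₀ :+ Y))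
               refl c₀ x₀ y₀ a b Σc′x′ Σc′y′ ⟩
  a * (c₀ * x₀ + Σc′x′) - b * (c₀ * y₀ + Σc′y′)
    ∎
  where
    open ≡-Reasoning
    c₀ x₀ y₀ Σc′x′ Σc′y′ : ℚ
    c₀ = c zero
    x₀ = x zero
    y₀ = y zero
    c′ x′ y′ : Fin n → ℚ
    c′ = c ∘ suc
    x′ = x ∘ suc
    y′ = y ∘ suc
    Σc′x′ = sumFin (λ j → c′ j * x′ j)
    Σc′y′ = sumFin (λ j → c′ j * y′ j)

δ : ∀ {n} → Fin n → ℚ → Fin n → ℚ
δ zero    α zero    = α
δ zero    α (suc t) = 0ℚ
δ (suc a) α zero    = 0ℚ
δ (suc a) α (suc t) = δ a α t

δ-diag : ∀ {n} (a : Fin n) α → δ a α a ≡ α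
δ-diag zero    α = refl
δ-diag (suc a) α = δ-diag a α

δ-off : ∀ {n} {a t : Fin n} α → t ≢ a → δ a α t ≡ 0ℚ
δ-off {a = zero}  {zero}  α t≢a = ⊥-elim (t≢a refl)
δ-off {a = zero}  {suc t} α t≢a = refl
δ-off {a = suc a} {zero}  α t≢a = refl
δ-off {a = suc a} {suc t} α t≢a = δ-off α (t≢a ∘ cong suc)

sumFin-δ : ∀ {n} (a : Fin n) α (f : Fin n → ℚ) → sumFin (λ t → δ a α t * f t) ≡ α * f a
sumFin-δ zero α f = begin
  α * f zero + sumFin (λ t → 0ℚ * f (suc t))
    ≡⟨ cong (α * f zero +_) (sumFin-≡0 (λ t → *-zeroˡ (f (suc t)))) ⟩
  α * f zero + 0ℚ
    ≡⟨ +-identityʳ (α * f zero) ⟩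
  α * f zero
    ∎
  where open ≡-Reasoning
sumFin-δ (suc a) α f = trans (cong₂ _+_ (*-zeroˡ (f zero)) (sumFin-δ a α (f ∘ suc))) (+-identityˡ _)

steiner-congʳ : ∀ O w {x y : Vec7} → x ≗ y → steiner O w x ≗ steiner O w y
steiner-congʳ O w x≗y k =
  sumFin-cong (λ i → sumFin-cong (λ j → cong (λ t → w i * t * basisProd O i j k) (x≗y j)))

pivotProduct≢0⇒linIndep : ∀ {m n} (M : Matrix m n) → pivotProduct M ≢ 0ℚ → LinIndep (column M)
pivotProduct≢0⇒linIndep {n = zero}      M _   c _ ()
pivotProduct≢0⇒linIndep {zero} {suc n}  M P≢0 = ⊥-elim (P≢0 refl)
pivotProduct≢0⇒linIndep {suc m} {suc n} M P≢0 c Mc≡0 = λ { zero → c₀≡0 ; (suc j) → c′≡0 j }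
  where
    open ≡-Reasoning
    a : ℚ
    a = M zero zero
    c′ : Fin n → ℚ
    c′ = c ∘ suc
    S : Fin (suc m) → ℚ
    S r = sumFin (λ j → c′ j * M r (suc j))
    -- Row i of eliminate M is a · (row i+1) - b · (row 0) of M with column 0 dropped; the
    -- column-0 terms, which carry c zero, cancel.
    eliminated≡0 : ∀ i → sumFin (λ j → c′ j * eliminate M i j) ≡ 0ℚ
    eliminated≡0 i = begin
      sumFin (λ j → c′ j * eliminate M i j)
        ≡⟨ sumFin-combination c′ _ _ a b ⟩
      a * S (suc i) - b * S zero
        ≡⟨ solve 5 (λ a b c₀ S S′ → a :* S :- b :* S′ := a :* (c₀ :* b :+ S) :- b :* (c₀ :* a :+ S′))
                   refl a b (c zero) (S (suc i)) (S zero) ⟩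
      a * (c zero * b + S (suc i)) - b * (c zero * a + S zero)
        ≡⟨ cong₂ (λ p q → a * p - b * q) (Mc≡0 (suc i)) (Mc≡0 zero) ⟩
      a * 0ℚ - b * 0ℚ
        ≡⟨ solve 2 (λ a b → a :* con 0ℚ :- b :* con 0ℚ := con 0ℚ) refl a b ⟩
      0ℚ
        ∎
      where
        b : ℚ
        b = M (suc i) zero
    c′≡0 : ∀ j → c′ j ≡ 0ℚ
    c′≡0 = pivotProduct≢0⇒linIndep (eliminate M)
             (λ P′≡0 → P≢0 (trans (cong (a *_) P′≡0) (*-zeroʳ a))) c′ eliminated≡0
    a≢0 : a ≢ 0ℚ
    a≢0 a≡0 = P≢0 (trans (cong (_* P′) a≡0) (*-zeroˡ P′))
      where
        P′ : ℚ
        P′ = pivotProduct (eliminate M)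
    c₀≡0 : c zero ≡ 0ℚ
    c₀≡0 = q*p≡0⇒q≡0 a≢0 (begin
      c zero * a             ≡⟨ sym (+-identityʳ (c zero * a)) ⟩
      c zero * a + 0ℚ        ≡⟨ cong (c zero * a +_) (sym (sumFin-≡0 (λ j →
                                  trans (cong (_* M zero (suc j)) (c′≡0 j)) (*-zeroˡ (M zero (suc j)))))) ⟩
      c zero * a + S zero    ≡⟨ Mc≡0 zero ⟩
      0ℚ                     ∎)

IsMultipleOf : ∀ {m} → (Fin m → ℚ) → (Fin m → ℚ) → Set
IsMultipleOf u x = ∃[ μ ] (∀ i → u i ≡ μ * x i)

isMultipleOf-refl : ∀ {m} {x : Fin m → ℚ} → IsMultipleOf x x
isMultipleOf-refl = 1ℚ , λ i → sym (*-identityˡ _)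

isMultipleOf-trans : ∀ {m} {x y z : Fin m → ℚ} → IsMultipleOf x y → IsMultipleOf y z → IsMultipleOf x z
isMultipleOf-trans (α , x≡αy) (β , y≡βz) =
  α * β , λ i → trans (x≡αy i) (trans (cong (α *_) (y≡βz i)) (sym (*-assoc α β _)))

-- If u a = α x and u b = β x, then β u a - α u b = 0; independence forces α = 0, so u a = 0.
twoMultiples⇒¬linIndep : ∀ {m r} (u : Fin r → Fin m → ℚ) (x : Fin m → ℚ) {a b : Fin r} →
                         a ≢ b → IsMultipleOf (u a) x → IsMultipleOf (u b) x → ¬ LinIndep u
twoMultiples⇒¬linIndep {r = r} u x {a} {b} a≢b (α , uₐ≡αx) (β , u_b≡βx) independent =
  1≢0 (trans (sym (δ-diag a 1ℚ)) (independent (δ a 1ℚ) uₐ≡0 a))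
  where
    open ≡-Reasoning
    c : Fin r → ℚ
    c t = δ a β t + δ b (- α) t
    c-annihilates : ∀ i → sumFin (λ t → c t * u t i) ≡ 0ℚ
    c-annihilates i = begin
      sumFin (λ t → c t * u t i)
        ≡⟨ sumFin-cong (λ t → *-distribʳ-+ (u t i) (δ a β t) (δ b (- α) t)) ⟩
      sumFin (λ t → δ a β t * u t i + δ b (- α) t * u t i)
        ≡⟨ sumFin-distrib-+ (λ t → δ a β t * u t i) (λ t → δ b (- α) t * u t i) ⟩
      sumFin (λ t → δ a β t * u t i) + sumFin (λ t → δ b (- α) t * u t i)
        ≡⟨ cong₂ _+_ (sumFin-δ a β _) (sumFin-δ b (- α) _) ⟩
      β * u a i + - α * u b i
        ≡⟨ cong₂ (λ p q → β * p + - α * q) (uₐ≡αx i) (u_b≡βx i) ⟩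
      β * (α * x i) + - α * (β * x i)
        ≡⟨ solve 3 (λ α β x → β :* (α :* x) :+ :- α :* (β :* x) := con 0ℚ) refl α β (x i) ⟩
      0ℚ
        ∎
    α≡0 : α ≡ 0ℚ
    α≡0 = neg-injective (begin
      - α           ≡⟨ sym (+-identityˡ (- α)) ⟩
      0ℚ + - α      ≡⟨ cong₂ _+_ (sym (δ-off β (a≢b ∘ sym))) (sym (δ-diag b (- α))) ⟩
      c b           ≡⟨ independent c c-annihilates b ⟩
      0ℚ            ∎)
    uₐ≡0 : ∀ i → sumFin (λ t → δ a 1ℚ t * u t i) ≡ 0ℚ
    uₐ≡0 i = begin
      sumFin (λ t → δ a 1ℚ t * u t i)   ≡⟨ sumFin-δ a 1ℚ _ ⟩
      1ℚ * u a i                        ≡⟨ *-identityˡ (u a i) ⟩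
      u a i                             ≡⟨ uₐ≡αx i ⟩
      α * x i                           ≡⟨ cong (_* x i) α≡0 ⟩
      0ℚ * x i                          ≡⟨ *-zeroˡ (x i) ⟩
      0ℚ                                ∎
    1≢0 : 1ℚ ≢ 0ℚ
    1≢0 ()

multiplesOfFewVectors⇒¬linIndep : ∀ {m r} (u : Fin (suc r) → Fin m → ℚ) (d : Fin r → Fin m → ℚ)
                                  (dir : Fin (suc r) → Fin r) →
                                  (∀ t → IsMultipleOf (u t) (d (dir t))) → ¬ LinIndep u
multiplesOfFewVectors⇒¬linIndep {r = r} u d dir multiple with pigeonhole (n<1+n r) dir
... | a , b , a<b , dirₐ≡dir_b =
  twoMultiples⇒¬linIndep u (d (dir a)) (<⇒≢ a<b) (multiple a)
    (subst (IsMultipleOf (u b) ∘ d) (sym dirₐ≡dir_b) (multiple b))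

Poly-rawRing : Set → RawRing 0ℓ 0ℓ
Poly-rawRing V = record
  { Carrier = Poly V ; _≈_ = _≡_ ; _+_ = _⊕_ ; _*_ = _⊗_
  ; -_ = con (- 1ℚ) ⊗_ ; 0# = con 0ℚ ; 1# = con 1ℚ }

eval-pivotProduct : ∀ {V} (ρ : V → ℚ) {m n} (M : Fin m → Fin n → Poly V) (N : Matrix m n) →
                    (∀ i j → eval ρ (M i j) ≡ N i j) →
                    eval ρ (Over.pivotProduct (Poly-rawRing V) M) ≡ pivotProduct N
eval-pivotProduct ρ {n = zero}      M N M≗N = refl
eval-pivotProduct ρ {zero} {suc n}  M N M≗N = refl
eval-pivotProduct ρ {suc m} {suc n} M N M≗N =
  cong₂ _*_ (M≗N zero zero) (eval-pivotProduct ρ (Over.eliminate (Poly-rawRing _) M) (eliminate N) eliminated)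
  where
    eliminated : ∀ i j → eval ρ (Over.eliminate (Poly-rawRing _) M i j) ≡ eliminate N i j
    eliminated i j =
      cong₂ _+_ (cong₂ _*_ (M≗N zero zero) (M≗N (suc i) (suc j)))
                (trans (-1*p≡-p _) (cong -_ (cong₂ _*_ (M≗N (suc i) zero) (M≗N zero (suc j)))))

LpowPoly : OSystem → ℕ → Pt → Poly (Pt ⊎ Pt)
LpowPoly O zero    = var ∘ inj₁
LpowPoly O (suc k) = Over.steinerOver (Poly-rawRing (Pt ⊎ Pt)) con O (var ∘ inj₂) (LpowPoly O k)

eval-LpowPoly : ∀ O k v w → eval (pairPt v w) ∘ LpowPoly O k ≗ Lpow O k w v
eval-LpowPoly O zero    v w i = refl
eval-LpowPoly O (suc k) v w i = steiner-congʳ O w (eval-LpowPoly O k v w) i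

generic-rank : ∀ O {r} (σ : Fin r → Fin 7) → Injective _≡_ _≡_ σ →
               ∀ v₀ w₀ (K₀ : Matrix 7 r) → (∀ i j → krylov O v₀ w₀ i (σ j) ≡ K₀ i j) →
               pivotProduct K₀ ≢ 0ℚ →
               (∀ v w (τ : Fin (suc r) → Fin 7) → Injective _≡_ _≡_ τ →
                  ¬ LinIndep (λ j → column (krylov O v w) (τ j))) →
               Generic (λ v w → HasRank (krylov O v w) r)
generic-rank O {r} σ σ-injective v₀ w₀ K₀ K₀-columns K₀-pivots rank≤r =
  p , (v₀ , w₀ , λ p≡0 → K₀-pivots (trans (sym (eval-p K₀-columns)) p≡0)) ,
  λ v w p≢0 →
    (σ , σ-injective , pivotProduct≢0⇒linIndep _ (λ P≡0 → p≢0 (trans (eval-p (λ _ _ → refl)) P≡0))) ,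
    rank≤r v w
  where
    p : Poly (Pt ⊎ Pt)
    p = Over.pivotProduct (Poly-rawRing (Pt ⊎ Pt)) (λ i j → LpowPoly O (toℕ (σ j)) i)
    eval-p : ∀ {v w} {N : Matrix 7 r} → (∀ i j → krylov O v w i (σ j) ≡ N i j) →
             eval (pairPt v w) p ≡ pivotProduct N
    eval-p {v} {w} columns =
      eval-pivotProduct (pairPt v w) _ _ (λ i j → trans (eval-LpowPoly O (toℕ (σ j)) v w i) (columns i j))

Polynomial-rawRing : ℕ → RawRing 0ℓ 0ℓ
Polynomial-rawRing n = record
  { Carrier = Polynomial n ; _≈_ = _≡_ ; _+_ = _:+_ ; _*_ = _:*_
  ; -_ = :-_ ; 0# = con 0ℚ ; 1# = con 1ℚ }

module 𝒮 = Over (Polynomial-rawRing 14)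

W X : Pt → Polynomial 14
W i = Sol.var (i ↑ˡ 7)
X i = Sol.var (7 ↑ʳ i)

env : Vec7 → Vec7 → Vec ℚ 14
env w x = tabulate w ++ tabulate x

-- Callers split on the coordinate k before invoking this: converting the solver's goal to the
-- ℚ-expression at a variable k is far slower than at each of the seven concrete ones.
byNormalisation : ∀ w x (P Q : Pt → Polynomial 14) k →
                  ⟦ P k ⟧↓ (env w x) ≡ ⟦ Q k ⟧↓ (env w x) → ⟦ P k ⟧ (env w x) ≡ ⟦ Q k ⟧ (env w x)
byNormalisation w x P Q k = Sol.prove (env w x) (P k) (Q k)

steiner-O-T-orthogonal : ∀ w x → dot w (steiner O-T w x) ≡ 0ℚ
steiner-O-T-orthogonal w x = Sol.prove (env w x) (𝒮.dot W (𝒮.steinerOver con O-T W X)) (con 0ℚ) refl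

-- The sparse form keeps the normal forms of the cubic identity below small.
steiner-O-T≡byTriples : ∀ w x → steiner O-T w x ≗ steinerByTriples O-T w x
steiner-O-T≡byTriples w x = λ
  { 0F → byNormalisation w x lhs rhs 0F refl ; 1F → byNormalisation w x lhs rhs 1F refl
  ; 2F → byNormalisation w x lhs rhs 2F refl ; 3F → byNormalisation w x lhs rhs 3F refl
  ; 4F → byNormalisation w x lhs rhs 4F refl ; 5F → byNormalisation w x lhs rhs 5F refl
  ; 6F → byNormalisation w x lhs rhs 6F refl }
  where
    lhs rhs : Pt → Polynomial 14
    lhs = 𝒮.steinerOver con O-T W X
    rhs = 𝒮.steinerByTriples O-T W X

byTriples-O-T-square : ∀ w x → steinerByTriples O-T w (steinerByTriples O-T w x)
                                 ≗ λ k → - dot w w * x k + dot w x * w k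
byTriples-O-T-square w x = λ
  { 0F → byNormalisation w x lhs rhs 0F refl ; 1F → byNormalisation w x lhs rhs 1F refl
  ; 2F → byNormalisation w x lhs rhs 2F refl ; 3F → byNormalisation w x lhs rhs 3F refl
  ; 4F → byNormalisation w x lhs rhs 4F refl ; 5F → byNormalisation w x lhs rhs 5F refl
  ; 6F → byNormalisation w x lhs rhs 6F refl }
  where
    lhs rhs : Pt → Polynomial 14
    lhs = 𝒮.steinerByTriples O-T W (𝒮.steinerByTriples O-T W X)
    rhs k = :- 𝒮.dot W W :* X k :+ 𝒮.dot W X :* W k

steiner-O-T-square : ∀ w x → steiner O-T w (steiner O-T w x) ≗ λ k → - dot w w * x k + dot w x * w k
steiner-O-T-square w x k = begin
  steiner O-T w (steiner O-T w x) k
    ≡⟨ steiner-congʳ O-T w (steiner-O-T≡byTriples w x) k ⟩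
  steiner O-T w (steinerByTriples O-T w x) k
    ≡⟨ steiner-O-T≡byTriples w (steinerByTriples O-T w x) k ⟩
  steinerByTriples O-T w (steinerByTriples O-T w x) k
    ≡⟨ byTriples-O-T-square w x k ⟩
  - dot w w * x k + dot w x * w k
    ∎
  where open ≡-Reasoning

Lpow-O-T-recurrence : ∀ v w k → IsMultipleOf (Lpow O-T (suc (suc (suc k))) w v) (Lpow O-T (suc k) w v)
Lpow-O-T-recurrence v w k = - dot w w , λ i → begin
  steiner O-T w (steiner O-T w y) i
    ≡⟨ steiner-O-T-square w y i ⟩
  - dot w w * y i + dot w y * w i
    ≡⟨ cong (λ t → - dot w w * y i + t * w i) (steiner-O-T-orthogonal w (Lpow O-T k w v)) ⟩
  - dot w w * y i + 0ℚ * w i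
    ≡⟨ solve 3 (λ n y w → n :* y :+ con 0ℚ :* w := n :* y) refl (- dot w w) (y i) (w i) ⟩
  - dot w w * y i
    ∎
  where
    open ≡-Reasoning
    y : Vec7
    y = Lpow O-T (suc k) w v

direction : Fin 7 → Fin 3
direction 0F = 0F
direction 1F = 1F
direction 2F = 2F
direction 3F = 1F
direction 4F = 2F
direction 5F = 1F
direction 6F = 2F

krylov-O-T-column : ∀ v w j →
                    IsMultipleOf (column (krylov O-T v w) j) (column (krylov O-T v w) (direction j ↑ˡ 4))
krylov-O-T-column v w 0F = isMultipleOf-refl
krylov-O-T-column v w 1F = isMultipleOf-refl
krylov-O-T-column v w 2F = isMultipleOf-refl
krylov-O-T-column v w 3F = Lpow-O-T-recurrence v w 0
krylov-O-T-column v w 4F = Lpow-O-T-recurrence v w 1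
krylov-O-T-column v w 5F = isMultipleOf-trans (Lpow-O-T-recurrence v w 2) (Lpow-O-T-recurrence v w 0)
krylov-O-T-column v w 6F = isMultipleOf-trans (Lpow-O-T-recurrence v w 3) (Lpow-O-T-recurrence v w 1)

krylov-O-T-rank≤3 : ∀ v w (τ : Fin 4 → Fin 7) → ¬ LinIndep (λ j → column (krylov O-T v w) (τ j))
krylov-O-T-rank≤3 v w τ =
  multiplesOfFewVectors⇒¬linIndep _ (λ c → column (krylov O-T v w) (c ↑ˡ 4)) (direction ∘ τ)
    (λ t → krylov-O-T-column v w (τ t))

krylov≡columns : ∀ O v w (K : Matrix 7 7) → (∀ i → v i ≡ K i zero) →
                 (∀ j i → steiner O w (column K (inject₁ j)) i ≡ K i (suc j)) →
                 ∀ i j → krylov O v w i j ≡ K i j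
krylov≡columns O v w K first next i j =
  <-weakInduction (λ j → ∀ i → krylov O v w i j ≡ K i j) first step j i
  where
    step : ∀ j → (∀ i → krylov O v w i (inject₁ j) ≡ K i (inject₁ j)) →
           ∀ i → krylov O v w i (suc j) ≡ K i (suc j)
    step j previous i = trans (steiner-congʳ O w previous′ i) (next j i)
      where
        previous′ : Lpow O (toℕ j) w v ≗ column K (inject₁ j)
        previous′ i = trans (cong (λ k → Lpow O k w v i) (sym (toℕ-inject₁ j))) (previous i)

fromColumns : ∀ {m n} → Vec (Fin m → ℚ) n → Matrix m n
fromColumns cs i j = lookup cs j i

-- Numeric literals are overloaded only inside this module; elsewhere the pending instance
-- constraints would block the arity argument of solve.
module Witness where
  open import Agda.Builtin.FromNat using (Number; fromNat)
  open import Agda.Builtin.FromNeg using (Negative; fromNeg)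
  open import Data.Unit using (tt)
  import Data.Nat.Literals as ℕ
  import Data.Rational.Literals as ℚ

  instance
    ℕ-number : Number ℕ
    ℕ-number = ℕ.number
    ℚ-number : Number ℚ
    ℚ-number = ℚ.number
    ℚ-negative : Negative ℚ
    ℚ-negative = ℚ.negative

  vec : Vec ℚ 7 → Vec7
  vec = lookup

  v₀ w₀ : Vec7
  v₀ = vec (1 ∷ 0 ∷ 0 ∷ 0 ∷ 0 ∷ 0 ∷ 0 ∷ [])
  w₀ = vec (1 ∷ 0 ∷ 1 ∷ 0 ∷ 0 ∷ 0 ∷ 1 ∷ [])

  -- The pivot products of the first three columns of K-O-T and of all of K-O'-T are 1 and 7077888.
  K-O-T K-O'-T : Matrix 7 7
  K-O-T = fromColumns
    ( v₀
    ∷ vec (  0 ∷  1 ∷  0 ∷ 0 ∷ 0 ∷ -1 ∷  0 ∷ [])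
    ∷ vec ( -2 ∷  0 ∷  1 ∷ 0 ∷ 0 ∷  0 ∷  1 ∷ [])
    ∷ vec (  0 ∷ -3 ∷  0 ∷ 0 ∷ 0 ∷  3 ∷  0 ∷ [])
    ∷ vec (  6 ∷  0 ∷ -3 ∷ 0 ∷ 0 ∷  0 ∷ -3 ∷ [])
    ∷ vec (  0 ∷  9 ∷  0 ∷ 0 ∷ 0 ∷ -9 ∷  0 ∷ [])
    ∷ vec (-18 ∷  0 ∷  9 ∷ 0 ∷ 0 ∷  0 ∷  9 ∷ [])
    ∷ [])
  K-O'-T = fromColumns
    ( v₀
    ∷ vec (  0 ∷  1 ∷  0 ∷  0 ∷   0 ∷  -1 ∷  0 ∷ [])
    ∷ vec ( -2 ∷  0 ∷  1 ∷  0 ∷   2 ∷   0 ∷  1 ∷ [])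
    ∷ vec (  0 ∷ -5 ∷  0 ∷ -2 ∷   0 ∷   5 ∷  0 ∷ [])
    ∷ vec ( 10 ∷  0 ∷ -3 ∷  0 ∷ -12 ∷   0 ∷ -7 ∷ [])
    ∷ vec (  0 ∷ 25 ∷  0 ∷ 16 ∷   0 ∷ -29 ∷  0 ∷ [])
    ∷ vec (-54 ∷  0 ∷  9 ∷  0 ∷  70 ∷   0 ∷ 45 ∷ [])
    ∷ [])

open Witness using (v₀; w₀; K-O-T; K-O'-T)

krylov-O-T-witness : ∀ i j → krylov O-T v₀ w₀ i j ≡ K-O-T i j
krylov-O-T-witness = krylov≡columns O-T v₀ w₀ K-O-T (λ _ → refl)
  (from-yes (all? λ j → all? λ i → steiner O-T w₀ (column K-O-T (inject₁ j)) i ≟ K-O-T i (suc j)))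

krylov-O'-T-witness : ∀ i j → krylov O'-T v₀ w₀ i j ≡ K-O'-T i j
krylov-O'-T-witness = krylov≡columns O'-T v₀ w₀ K-O'-T (λ _ → refl)
  (from-yes (all? λ j → all? λ i → steiner O'-T w₀ (column K-O'-T (inject₁ j)) i ≟ K-O'-T i (suc j)))

proposition7 : Generic (λ v w → HasRank (krylov O-T v w) 3)
               × Generic (λ v w → HasRank (krylov O'-T v w) 7)
proposition7 =
  generic-rank O-T (_↑ˡ 4) (λ {i} {j} → ↑ˡ-injective 4 i j) v₀ w₀ (λ i j → K-O-T i (j ↑ˡ 4))
    (λ i j → krylov-O-T-witness i (j ↑ˡ 4)) (λ ()) (λ v w τ _ → krylov-O-T-rank≤3 v w τ) ,
  generic-rank O'-T id id v₀ w₀ K-O'-T krylov-O'-T-witness (λ ())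
    (λ v w τ τ-injective _ → <-irrefl refl (injective⇒≤ τ-injective))
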